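{- Let $X$ be a subset of an abelian group with $0\in X$, and let $k\ge1$ be an integer. Let $P=\{\sum_{i=1}^r x_ia_i: |x_i|\le N_i\}$ be a symmetric 2-proper GAP that contains $kX$. Then $$X\subset\Big\{\sum_{i=1}^r x_ia_i: |x_i|\le 2N_i/k\Big\}.$$
   Context: The $x_i$ range over integers. The iterated sumset is $kX:=\{a_1+\dots+a_k: a_i\in X\}$. A GAP $\{\sum_i x_ia_i: |x_i|\le N_i\}$ is proper if the map $(x_i)\mapsto\sum_i x_ia_i$ on the box $\{|x_i|\le N_i\}$ is injective. It is 2-proper if the GAP $2P=\{\sum_i x_ia_i: |x_i|\le 2N_i\}$ is proper. -}

module Defs where

open import Level using (Level; _⊔_)
open import Data.Nat using (ℕ; zero; suc)
open import Data.Integer using (ℤ; +_; -[1+_])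
open import Data.Fin using (Fin; zero; suc)
open import Algebra.Bundles using (AbelianGroup)

module _ {c ℓ : Level} (G : AbelianGroup c ℓ) where
  open AbelianGroup G

  ℕ-scale : ℕ → Carrier → Carrier
  ℕ-scale zero    g = ε
  ℕ-scale (suc n) g = g ∙ ℕ-scale n g

  ℤ-scale : ℤ → Carrier → Carrier
  ℤ-scale (+ n)    g = ℕ-scale n g
  ℤ-scale -[1+ n ] g = (ℕ-scale (suc n) g) ⁻¹

  gsum : (r : ℕ) → (Fin r → Carrier) → Carrier
  gsum zero    f = ε
  gsum (suc r) f = f zero ∙ gsum r (λ i → f (suc i))

  combo : (r : ℕ) → (Fin r → ℤ) → (Fin r → Carrier) → Carrier
  combo r x a = gsum r (λ i → ℤ-scale (x i) (a i))

module Submission where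

-- Write g ∈ X as g = g + 0 + ... + 0 ∈ kX ⊆ P, so
-- g = Σ xᵢ aᵢ with |xᵢ| ≤ Nᵢ. More generally, for every m ≤ k the element
-- m·g is a sum of m copies of g and k − m copies of 0, hence m·g ∈ P. We show
-- by induction on m ≤ k that m|xᵢ| ≤ Nᵢ: if m|xᵢ| ≤ Nᵢ, then the coefficient
-- vector (m+1)x has |(m+1)xᵢ| = |xᵢ| + m|xᵢ| ≤ 2Nᵢ and represents (m+1)·g,
-- which also has a representation y in the box |yᵢ| ≤ Nᵢ. Since P is
-- 2-proper, (m+1)x = y, so (m+1)|xᵢ| ≤ Nᵢ. At m = k this gives k|xᵢ| ≤ Nᵢ,
-- which is even stronger than the claimed bound k|xᵢ| ≤ 2Nᵢ.

open import Defs
open import Level using (Level)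
open import Data.Nat using (ℕ; zero; suc; _≤_; _*_; z≤n; s≤s)
open import Data.Nat.Properties
  using (≤-refl; ≤-trans; ≤-reflexive; <⇒≤; +-mono-≤; +-identityʳ; m≤m+n; module ≤-Reasoning)
open import Data.Integer using (ℤ; +_; -[1+_]; ∣_∣; _◃_) renaming (_*_ to _*ℤ_)
open import Data.Integer.Properties using (∣i*j∣≡∣i∣*∣j∣; +◃n≡+n)
open import Data.Sign using (Sign)
open import Data.Fin using (Fin; zero; suc)
open import Data.Product using (Σ; _×_; _,_)
open import Relation.Binary.PropositionalEquality as ≡ using (_≡_)
open import Algebra.Bundles using (AbelianGroup)

module GroupFacts {c ℓ : Level} (G : AbelianGroup c ℓ) where
  open AbelianGroup G
  open import Algebra.Definitions.RawMonoid rawMonoid using () renaming (_×_ to _·_)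
  open import Algebra.Properties.CommutativeMonoid.Mult commutativeMonoid
    using (×-assocˡ; ×-distrib-+)
  open import Algebra.Properties.AbelianGroup G using (ε⁻¹≈ε; ⁻¹-∙-comm)
  open import Relation.Binary.Reasoning.Setoid setoid

  ℕ-scale≡· : ∀ n g → ℕ-scale G n g ≡ n · g
  ℕ-scale≡· zero    g = ≡.refl
  ℕ-scale≡· (suc n) g = ≡.cong (g ∙_) (ℕ-scale≡· n g)

  ·-⁻¹ : ∀ m g → m · (g ⁻¹) ≈ (m · g) ⁻¹
  ·-⁻¹ zero    g = sym ε⁻¹≈ε
  ·-⁻¹ (suc m) g = trans (∙-congˡ (·-⁻¹ m g)) (⁻¹-∙-comm g (m · g))

  ℤ-scale-neg : ∀ t g → ℤ-scale G (Sign.- ◃ t) g ≈ (t · g) ⁻¹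
  ℤ-scale-neg zero    g = sym ε⁻¹≈ε
  ℤ-scale-neg (suc t) g = ⁻¹-cong (reflexive (ℕ-scale≡· (suc t) g))

  ℤ-scale-dilate : ∀ m z g → ℤ-scale G (+ m *ℤ z) g ≈ m · ℤ-scale G z g
  ℤ-scale-dilate m (+ n) g = begin
    ℤ-scale G (+ m *ℤ + n) g  ≡⟨ ≡.cong (λ z → ℤ-scale G z g) (+◃n≡+n (m * n)) ⟩
    ℕ-scale G (m * n) g       ≡⟨ ℕ-scale≡· (m * n) g ⟩
    (m * n) · g               ≈⟨ ×-assocˡ g m n ⟨
    m · (n · g)               ≡⟨ ≡.cong (m ·_) (ℕ-scale≡· n g) ⟨
    m · ℕ-scale G n g         ∎
  ℤ-scale-dilate m -[1+ n ] g = begin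
    ℤ-scale G (Sign.- ◃ (m * suc n)) g  ≈⟨ ℤ-scale-neg (m * suc n) g ⟩
    ((m * suc n) · g) ⁻¹                ≈⟨ ⁻¹-cong (×-assocˡ g m (suc n)) ⟨
    (m · (suc n · g)) ⁻¹                ≈⟨ ·-⁻¹ m (suc n · g) ⟨
    m · ((suc n · g) ⁻¹)                ≡⟨ ≡.cong (λ h → m · (h ⁻¹)) (ℕ-scale≡· (suc n) g) ⟨
    m · ℤ-scale G -[1+ n ] g            ∎

  gsum-cong : ∀ r {f h : Fin r → Carrier} → (∀ i → f i ≈ h i) → gsum G r f ≈ gsum G r h
  gsum-cong zero    f≈h = refl
  gsum-cong (suc r) f≈h = ∙-cong (f≈h zero) (gsum-cong r (λ i → f≈h (suc i)))

  gsum-ε : ∀ r → gsum G r (λ _ → ε) ≈ ε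
  gsum-ε zero    = refl
  gsum-ε (suc r) = trans (∙-congˡ (gsum-ε r)) (identityˡ ε)

  ·-ε : ∀ m → m · ε ≈ ε
  ·-ε zero    = refl
  ·-ε (suc m) = trans (∙-congˡ (·-ε m)) (identityˡ ε)

  gsum-· : ∀ m r (f : Fin r → Carrier) → gsum G r (λ i → m · f i) ≈ m · gsum G r f
  gsum-· m zero    f = sym (·-ε m)
  gsum-· m (suc r) f = begin
    m · f zero ∙ gsum G r (λ i → m · f (suc i))  ≈⟨ ∙-congˡ (gsum-· m r (λ i → f (suc i))) ⟩
    m · f zero ∙ m · gsum G r (λ i → f (suc i))  ≈⟨ ×-distrib-+ (f zero) _ m ⟨
    m · gsum G (suc r) f                         ∎

  combo-dilate : ∀ r m (x : Fin r → ℤ) (a : Fin r → Carrier) →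
    combo G r (λ i → + m *ℤ x i) a ≈ m · combo G r x a
  combo-dilate r m x a =
    trans (gsum-cong r (λ i → ℤ-scale-dilate m (x i) (a i)))
          (gsum-· m r (λ i → ℤ-scale G (x i) (a i)))

module Padding {c ℓ : Level} (G : AbelianGroup c ℓ) where
  open AbelianGroup G
  open import Algebra.Definitions.RawMonoid rawMonoid using () renaming (_×_ to _·_)
  open GroupFacts G using (gsum-ε)

  copies : Carrier → ℕ → {k : ℕ} → Fin k → Carrier
  copies g zero    j       = ε
  copies g (suc m) zero    = g
  copies g (suc m) (suc j) = copies g m j

  copies-sum : ∀ g {k} m → m ≤ k → gsum G k (copies g m) ≈ m · g
  copies-sum g {k}     zero    _         = gsum-ε k
  copies-sum g {suc k} (suc m) (s≤s m≤k) = ∙-congˡ (copies-sum g m m≤k)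

  copies-in : ∀ {p} (X : Carrier → Set p) → X ε → ∀ {g} → X g →
    ∀ m {k} (j : Fin k) → X (copies g m j)
  copies-in X Xε Xg zero    j       = Xε
  copies-in X Xε Xg (suc m) zero    = Xg
  copies-in X Xε Xg (suc m) (suc j) = copies-in X Xε Xg m j

module Progression {c ℓ : Level} (G : AbelianGroup c ℓ) {r : ℕ} (a : Fin r → AbelianGroup.Carrier G) where
  open AbelianGroup G
  open import Algebra.Definitions.RawMonoid rawMonoid using () renaming (_×_ to _·_)
  open import Algebra.Properties.CommutativeMonoid.Mult commutativeMonoid using (×-congʳ)
  open GroupFacts G using (combo-dilate)

  InBox : (Fin r → ℕ) → (Fin r → ℤ) → Set
  InBox B x = ∀ i → ∣ x i ∣ ≤ B i

  InGAP : (Fin r → ℕ) → Carrier → Set ℓ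
  InGAP B g = Σ (Fin r → ℤ) λ x → InBox B x × g ≈ combo G r x a

  Proper : (Fin r → ℕ) → Set ℓ
  Proper B = ∀ x y → InBox B x → InBox B y → combo G r x a ≈ combo G r y a → ∀ i → x i ≡ y i

  dilation-bound : ∀ {N k g} → Proper (λ i → 2 * N i) → ∀ x → InBox N x → g ≈ combo G r x a →
    (∀ m → suc m ≤ k → InGAP N (suc m · g)) →
    ∀ m → m ≤ k → ∀ i → m * ∣ x i ∣ ≤ N i
  dilation-bound proper x x≤N g≈x multiple zero    _   i = z≤n
  dilation-bound {N} proper x x≤N g≈x multiple (suc m) m<k i
    with multiple m m<k
  ... | y , y≤N , mg≈y = begin
    suc m * ∣ x i ∣          ≡⟨ ∣i*j∣≡∣i∣*∣j∣ (+ suc m) (x i) ⟨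
    ∣ + suc m *ℤ x i ∣       ≡⟨ ≡.cong ∣_∣ (dilated≡y i) ⟩
    ∣ y i ∣                  ≤⟨ y≤N i ⟩
    N i                      ∎
    where
    open ≤-Reasoning
    smaller : ∀ i → m * ∣ x i ∣ ≤ N i
    smaller = dilation-bound proper x x≤N g≈x multiple m (<⇒≤ m<k)
    -- |(m+1)xᵢ| = |xᵢ| + m|xᵢ| ≤ Nᵢ + Nᵢ, so (m+1)x lies in the doubled box.
    dilated-in-2N : InBox (λ i → 2 * N i) (λ i → + suc m *ℤ x i)
    dilated-in-2N i = ≤-trans (≤-reflexive (∣i*j∣≡∣i∣*∣j∣ (+ suc m) (x i)))
      (+-mono-≤ (x≤N i) (≤-trans (smaller i) (≤-reflexive (≡.sym (+-identityʳ (N i))))))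
    y-in-2N : InBox (λ i → 2 * N i) y
    y-in-2N i = ≤-trans (y≤N i) (m≤m+n (N i) _)
    -- Both (m+1)x and y represent (m+1)·g, so 2-properness identifies them.
    dilated≈y : combo G r (λ i → + suc m *ℤ x i) a ≈ combo G r y a
    dilated≈y = trans (combo-dilate r (suc m) x a) (trans (×-congʳ (suc m) (sym g≈x)) mg≈y)
    dilated≡y : ∀ i → + suc m *ℤ x i ≡ y i
    dilated≡y = proper _ y dilated-in-2N y-in-2N dilated≈y

lemmaA2 : {c ℓ p : Level} (G : AbelianGroup c ℓ) (X : AbelianGroup.Carrier G → Set p)
    → X (AbelianGroup.ε G)
    → (k : ℕ) → 1 ≤ k
    → (r : ℕ) (a : Fin r → AbelianGroup.Carrier G) (N : Fin r → ℕ)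
    → ((x y : Fin r → ℤ)
         → ((i : Fin r) → ∣ x i ∣ ≤ 2 * N i) → ((i : Fin r) → ∣ y i ∣ ≤ 2 * N i)
         → AbelianGroup._≈_ G (combo G r x a) (combo G r y a)
         → (i : Fin r) → x i ≡ y i)
    → ((s : Fin k → AbelianGroup.Carrier G) → ((j : Fin k) → X (s j))
         → Σ (Fin r → ℤ) (λ x → ((i : Fin r) → ∣ x i ∣ ≤ N i)
              × AbelianGroup._≈_ G (gsum G k s) (combo G r x a)))
    → (g : AbelianGroup.Carrier G) → X g
    → Σ (Fin r → ℤ) (λ x → ((i : Fin r) → k * ∣ x i ∣ ≤ 2 * N i)
         × AbelianGroup._≈_ G g (combo G r x a))
lemmaA2 G X Xε k 1≤k r a N proper kX⊆P g Xg = bound-coefficients g-in-P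
  where
  open AbelianGroup G
  open import Algebra.Definitions.RawMonoid rawMonoid using () renaming (_×_ to _·_)
  open Padding G
  open Progression G a using (InGAP; dilation-bound)

  -- m·g = g + … + g + 0 + … + 0 ∈ kX ⊆ P whenever m ≤ k.
  multiple : ∀ m → m ≤ k → InGAP N (m · g)
  multiple m m≤k with kX⊆P (copies g m) (copies-in X Xε Xg m)
  ... | y , y≤N , sum≈y = y , y≤N , trans (sym (copies-sum g m m≤k)) sum≈y

  g-in-P : InGAP N g
  g-in-P with multiple 1 1≤k
  ... | x , x≤N , 1·g≈x = x , x≤N , trans (sym (identityʳ g)) 1·g≈x

  bound-coefficients : InGAP N g →
    Σ (Fin r → ℤ) λ x → (∀ i → k * ∣ x i ∣ ≤ 2 * N i) × g ≈ combo G r x a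
  bound-coefficients (x , x≤N , g≈x) = x , k·x≤2N , g≈x
    where
    k·x≤2N : ∀ i → k * ∣ x i ∣ ≤ 2 * N i
    k·x≤2N i = ≤-trans (dilation-bound proper x x≤N g≈x (λ m → multiple (suc m)) k ≤-refl i)
                       (m≤m+n (N i) _)
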